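{- Let $K$ be a real quadratic field with associated quantities $\Delta_0$, $f_j$, $d_j$, $\Delta_j$ as below, and let $j,n$ be positive integers. (1) $d_j$ divides $d_{nj}$ if and only if $n\not\equiv 0\pmod 3$. (2) If $d_j$ is odd, then: (a) $\Delta_0\equiv 0\pmod 4$ if $f_j$ is odd; (b) $\Delta_{nj}\equiv 0\pmod 4$ for all $n$; (c) $d_{nj}$ is odd for all $n$; (d) if $f_j$ is even then $f_{nj}$ is even for all $n$; (e) if $f_j$ is odd then $f_{nj}$ is odd if and only if $n$ is odd. (3) If $d_j$ is even, then: (a) $\Delta_0\equiv 1\pmod 4$; (b) $\Delta_{nj}\equiv 1\pmod 4$ if and only if $n\not\equiv 0\pmod 3$; (c) $d_{nj}$ is even if and only if $n\not\equiv 0\pmod 3$; (d) $f_{nj}$ is odd if and only if $n\not\equiv 0\pmod 3$.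
   Context: Let $K\subset\mathbb{R}$ be a real quadratic field of discriminant $\Delta_0$, and let $\varepsilon$ be the smallest unit of $K$ of norm $+1$ that is greater than $1$. For positive integers $j$ set $f_j=(\varepsilon^j-\varepsilon^{ -j})/\sqrt{\Delta_0}$, $d_j=f_{2j}/f_j+1$ (which equals $\varepsilon^j+\varepsilon^{ -j}+1$; both $f_j,d_j$ are integers), and $\Delta_j=(d_j-3)(d_j+1)$. -}

module Defs where

open import Data.Nat as ℕ using (ℕ; zero; suc; _<_; _≤_; _%_)
open import Data.Nat.Divisibility as ℕD using ()
open import Data.Integer as ℤ using (ℤ; +_)
open import Data.Product using (_×_; Σ)
open import Data.Sum using (_⊎_)
open import Relation.Binary.PropositionalEquality using (_≡_)

Squarefree : ℕ → Set
Squarefree m = ∀ (k : ℕ) → (k ℕ.* k) ℕD.∣ m → k ≡ 1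

IsRealQuadDisc : ℕ → Set
IsRealQuadDisc D =
  1 < D ×
  ((D % 4 ≡ 1 × Squarefree D) ⊎
   Σ ℕ (λ m → D ≡ 4 ℕ.* m × (m % 4 ≡ 2 ⊎ m % 4 ≡ 3) × Squarefree m))

-- (t , u) with t,u > 0 and t² - Δ₀ u² = 4 is exactly a unit
-- (t + u√Δ₀)/2 > 1 of norm +1 of O_K.
IsNormOneUnitGt1 : ℕ → ℕ → ℕ → Set
IsNormOneUnitGt1 D t u = 0 < t × 0 < u × t ℕ.* t ≡ D ℕ.* (u ℕ.* u) ℕ.+ 4

IsSmallestNormOneUnit : ℕ → ℕ → ℕ → Set
IsSmallestNormOneUnit D t u =
  IsNormOneUnitGt1 D t u ×
  (∀ t' u' → IsNormOneUnitGt1 D t' u' → u ≤ u')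

-- ε^j = (V j + Y j √Δ₀)/2 and ε^{-j} = (V j - Y j √Δ₀)/2 where
-- V 0 = 2, V 1 = t, Y 0 = 0, Y 1 = u, and both satisfy
-- X (j+2) = t X (j+1) - X j   (since ε + ε⁻¹ = t, ε ε⁻¹ = 1).
V : ℕ → ℕ → ℤ
V t zero = + 2
V t (suc zero) = + t
V t (suc (suc j)) = (+ t) ℤ.* V t (suc j) ℤ.- V t j

Y : ℕ → ℕ → ℕ → ℤ
Y t u zero = + 0
Y t u (suc zero) = + u
Y t u (suc (suc j)) = (+ t) ℤ.* Y t u (suc j) ℤ.- Y t u j

-- f j = (ε^j - ε^{-j}) / √Δ₀
f : ℕ → ℕ → ℕ → ℤ
f t u j = Y t u j

-- d j = ε^j + ε^{-j} + 1  (= f (2j) / f j + 1)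
d : ℕ → ℕ → ℤ
d t j = V t j ℤ.+ + 1

Δ : ℕ → ℕ → ℤ
Δ t j = (d t j ℤ.- + 3) ℤ.* (d t j ℤ.+ + 1)

{-# OPTIONS --safe #-}
module Submission where

open import Defs
open import Data.Nat as ℕ using (ℕ; _<_)
open import Data.Nat.Divisibility as ℕD using ()
open import Data.Integer as ℤ using (ℤ; +_)
open import Data.Integer.Divisibility as ℤD using ()
open import Data.Product using (_×_)
open import Function.Bundles using (_⇔_)
open import Relation.Nullary using (¬_)

open import Agda.Primitive using (lzero)
open import Data.Nat.Base using (zero; suc; s≤s)
import Data.Nat.Properties as ℕP
import Data.Nat.Tactic.RingSolver as ℕSolver
open import Data.Integer.Base using (_+_; _-_; _*_; -_)
import Data.Integer.Properties as ℤP
import Data.Integer.DivMod as ℤDivMod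
open import Data.Integer.Divisibility.Signed
open import Data.Integer.Tactic.RingSolver using (solve-∀)
open import Data.Product using (_,_; ∃₂; proj₁)
open import Data.Sum using (_⊎_; inj₁; inj₂)
open import Data.Empty using (⊥-elim)
open import Function.Base using (_∘_)
open import Function.Bundles using (mk⇔)
open import Function.Properties.Equivalence using (⇔-isEquivalence)
open import Function.Related.TypeIsomorphisms using (¬-cong-⇔)
open import Relation.Binary.Structures using (IsEquivalence)
open import Relation.Nullary.Decidable using (from-no)
open import Relation.Binary.PropositionalEquality
  using (_≡_; refl; sym; trans; cong; cong₂; subst; module ≡-Reasoning)

-- Put r = V_j = ε^j + ε^-j.  Both n ↦ V_{nj} and n ↦ f_{nj} satisfy
-- Z_{n+2} = r Z_{n+1} - Z_n, and every such sequence has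
-- Z_{n+3} - Z_n = (r + 1)((r - 1) Z_{n+1} - Z_n)  and  Z_{n+2} + Z_n = r Z_{n+1}.
-- So modulo d_j = r + 1 (and modulo 2 when r is odd) these sequences are
-- 3-periodic, modulo 2 when r is even they are 2-periodic, and all parts are
-- read off from the first terms.  The claims about Δ₀ come from the norm
-- equation V_j² - Δ₀ f_j² = 4, and d_j ∤ 3 holds because V_j ≥ 3.

private
  module ⇔ = IsEquivalence (⇔-isEquivalence {lzero})

-- The theorem uses the unsigned divisibility ℤD._∣_; the proofs work with the
-- signed _∣_, which comes with closure under + and -.
∣ᵤ⇔∣ : ∀ {k i} → k ℤD.∣ i ⇔ k ∣ i
∣ᵤ⇔∣ = mk⇔ ∣ᵤ⇒∣ ∣⇒∣ᵤ

∣m-n⇒∣m⇔∣n : ∀ {k m n} → k ∣ m - n → k ∣ m ⇔ k ∣ n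
∣m-n⇒∣m⇔∣n {k} {m} {n} k∣m-n = mk⇔
  (λ k∣m → subst (k ∣_) (ℤP.neg-involutive n) (∣m⇒∣-m (∣m+n∣m⇒∣n k∣m-n k∣m)))
  (λ k∣n → ∣m+n∣n⇒∣m k∣m-n (∣m⇒∣-m k∣n))

∣m+n⇒∣m⇔∣n : ∀ {k m n} → k ∣ m + n → k ∣ m ⇔ k ∣ n
∣m+n⇒∣m⇔∣n k∣m+n = mk⇔ (∣m+n∣m⇒∣n k∣m+n) (∣m+n∣n⇒∣m k∣m+n)

∣m-1⇒∣m∸1 : ∀ {k m} → + k ∣ + m - + 1 → k ℕD.∣ m ℕ.∸ 1
∣m-1⇒∣m∸1 {k} {zero}  _ = k ℕD.∣0
∣m-1⇒∣m∸1 {k} {suc m} k∣m = ∣⇒∣ᵤ k∣m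

-- A record rather than a Π-type, so that r and X can be inferred from a proof.
record Recurrent (r : ℤ) (X : ℕ → ℤ) : Set where
  constructor recurrent
  field recurrence : ∀ n → X (suc (suc n)) ≡ r * X (suc n) - X n
open Recurrent

V-recurrent : ∀ t → Recurrent (+ t) (V t)
V-recurrent t = recurrent (λ _ → refl)

Y-recurrent : ∀ t u → Recurrent (+ t) (Y t u)
Y-recurrent t u = recurrent (λ _ → refl)

Vₖ*Xₖ≡X₂ₖ+X₀ : ∀ {t X} → Recurrent (+ t) X → ∀ k → V t k * X k ≡ X (k ℕ.* 2) + X 0
Vₖ*Xₖ≡X₂ₖ+X₀ {X = X} _ zero = double (X 0)
  where
  double : ∀ x → + 2 * x ≡ x + x
  double = solve-∀
Vₖ*Xₖ≡X₂ₖ+X₀ {t} {X} (recurrent rec) (suc zero) =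
  trans (cancel (+ t * X 1) (X 0)) (cong (_+ X 0) (sym (rec 0)))
  where
  cancel : ∀ a b → a ≡ (a - b) + b
  cancel = solve-∀
Vₖ*Xₖ≡X₂ₖ+X₀ {t} {X} (recurrent rec) (suc (suc k)) = begin
  (+ t * V t (suc k) - V t k) * X (2 ℕ.+ k)
    ≡⟨ distrib (+ t) (V t (suc k)) (V t k) (X (2 ℕ.+ k)) ⟩
  + t * (V t (suc k) * X (2 ℕ.+ k)) - V t k * X (2 ℕ.+ k)
    ≡⟨ cong₂ (λ a b → + t * a - b) (Vₖ*Xₖ≡X₂ₖ+X₀ (recurrent (rec ∘ suc)) (suc k))
                                   (Vₖ*Xₖ≡X₂ₖ+X₀ (recurrent (rec ∘ suc ∘ suc)) k) ⟩
  + t * (X (3 ℕ.+ k ℕ.* 2) + X 1) - (X (2 ℕ.+ k ℕ.* 2) + X 2)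
    ≡⟨ cong (λ x → + t * (X (3 ℕ.+ k ℕ.* 2) + X 1) - (X (2 ℕ.+ k ℕ.* 2) + x)) (rec 0) ⟩
  + t * (X (3 ℕ.+ k ℕ.* 2) + X 1) - (X (2 ℕ.+ k ℕ.* 2) + (+ t * X 1 - X 0))
    ≡⟨ regroup (+ t) (X (3 ℕ.+ k ℕ.* 2)) (X (2 ℕ.+ k ℕ.* 2)) (X 1) (X 0) ⟩
  (+ t * X (3 ℕ.+ k ℕ.* 2) - X (2 ℕ.+ k ℕ.* 2)) + X 0
    ≡⟨ cong (_+ X 0) (sym (rec (2 ℕ.+ k ℕ.* 2))) ⟩
  X (4 ℕ.+ k ℕ.* 2) + X 0 ∎
  where
  open ≡-Reasoning
  distrib : ∀ T v₁ v₀ x → (T * v₁ - v₀) * x ≡ T * (v₁ * x) - v₀ * x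
  distrib = solve-∀
  regroup : ∀ T a b c e → T * (a + c) - (b + (T * c - e)) ≡ (T * a - b) + e
  regroup = solve-∀

recurrent-∘* : ∀ {t X} → Recurrent (+ t) X → ∀ j → Recurrent (V t j) (λ n → X (n ℕ.* j))
recurrent-∘* {t} {X} (recurrent rec) j = recurrent step
  where
  open ≡-Reasoning
  index : ∀ j m → j ℕ.+ (j ℕ.+ m) ≡ j ℕ.* 2 ℕ.+ m
  index = ℕSolver.solve-∀
  cancel : ∀ a b → a ≡ (a + b) - b
  cancel = solve-∀
  step : ∀ n → X (suc (suc n) ℕ.* j) ≡ V t j * X (suc n ℕ.* j) - X (n ℕ.* j)
  step n = begin
    X (j ℕ.+ (j ℕ.+ n ℕ.* j))                             ≡⟨ cong X (index j (n ℕ.* j)) ⟩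
    X (j ℕ.* 2 ℕ.+ n ℕ.* j)                               ≡⟨ cancel _ (X (n ℕ.* j)) ⟩
    (X (j ℕ.* 2 ℕ.+ n ℕ.* j) + X (n ℕ.* j)) - X (n ℕ.* j) ≡⟨ cong (_- X (n ℕ.* j)) (sym doubling) ⟩
    V t j * X (j ℕ.+ n ℕ.* j) - X (n ℕ.* j)               ∎
    where
    doubling : V t j * X (j ℕ.+ n ℕ.* j) ≡ X (j ℕ.* 2 ℕ.+ n ℕ.* j) + X (n ℕ.* j)
    doubling = Vₖ*Xₖ≡X₂ₖ+X₀ (recurrent λ m → rec (m ℕ.+ n ℕ.* j)) j

X[1*j]≡X[j] : ∀ (X : ℕ → ℤ) j → X (1 ℕ.* j) ≡ X j
X[1*j]≡X[j] X j = cong X (ℕP.*-identityˡ j)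

recurrent-∣ : ∀ {r X k} → Recurrent r X → k ∣ X 0 → k ∣ X 1 → ∀ n → k ∣ X n
recurrent-∣ {r} {X} {k} (recurrent rec) k∣X₀ k∣X₁ n = proj₁ (consecutive n)
  where
  consecutive : ∀ n → k ∣ X n × k ∣ X (suc n)
  consecutive zero = k∣X₀ , k∣X₁
  consecutive (suc n) with consecutive n
  ... | k∣Xₙ , k∣X₁₊ₙ = k∣X₁₊ₙ , subst (k ∣_) (sym (rec n)) (∣m∣n⇒∣m-n (∣n⇒∣m*n r k∣X₁₊ₙ) k∣Xₙ)

r+1∣X₃₊ₙ-Xₙ : ∀ {r X} → Recurrent r X → ∀ n → r + + 1 ∣ X (3 ℕ.+ n) - X n
r+1∣X₃₊ₙ-Xₙ {r} {X} (recurrent rec) n = divides ((r - + 1) * X (suc n) - X n) (begin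
  X (3 ℕ.+ n) - X n                                 ≡⟨ cong (_- X n) (rec (suc n)) ⟩
  r * X (2 ℕ.+ n) - X (suc n) - X n                 ≡⟨ cong (λ x → r * x - X (suc n) - X n) (rec n) ⟩
  r * (r * X (suc n) - X n) - X (suc n) - X n       ≡⟨ factor r (X (suc n)) (X n) ⟩
  ((r - + 1) * X (suc n) - X n) * (r + + 1)         ∎)
  where
  open ≡-Reasoning
  factor : ∀ r a b → r * (r * a - b) - a - b ≡ ((r - + 1) * a - b) * (r + + 1)
  factor = solve-∀

r∣X₂₊ₙ+Xₙ : ∀ {r X} → Recurrent r X → ∀ n → r ∣ X (2 ℕ.+ n) + X n
r∣X₂₊ₙ+Xₙ {r} {X} (recurrent rec) n =
  divides (X (suc n)) (trans (cong (_+ X n) (rec n)) (cancel r (X (suc n)) (X n)))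
  where
  cancel : ∀ r a b → (r * a - b) + b ≡ a * r
  cancel = solve-∀

3-periodic⇒⇔∤3 : ∀ {Q : ℕ → Set} → ¬ Q 0 → Q 1 → Q 2 → (∀ n → Q (3 ℕ.+ n) ⇔ Q n) →
                 ∀ n → Q n ⇔ (¬ 3 ℕD.∣ n)
3-periodic⇒⇔∤3 ¬Q₀ Q₁ Q₂ period zero = mk⇔ (⊥-elim ∘ ¬Q₀) (λ 3∤0 → ⊥-elim (3∤0 (3 ℕD.∣0)))
3-periodic⇒⇔∤3 ¬Q₀ Q₁ Q₂ period 1 = mk⇔ (λ _ → from-no (3 ℕD.∣? 1)) (λ _ → Q₁)
3-periodic⇒⇔∤3 ¬Q₀ Q₁ Q₂ period 2 = mk⇔ (λ _ → from-no (3 ℕD.∣? 2)) (λ _ → Q₂)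
3-periodic⇒⇔∤3 ¬Q₀ Q₁ Q₂ period (suc (suc (suc n))) =
  ⇔.trans (period n) (⇔.trans (3-periodic⇒⇔∤3 ¬Q₀ Q₁ Q₂ period n) (¬-cong-⇔ 3∣n⇔3∣3+n))
  where
  3∣n⇔3∣3+n : 3 ℕD.∣ n ⇔ 3 ℕD.∣ 3 ℕ.+ n
  3∣n⇔3∣3+n = mk⇔ (ℕD.∣m∣n⇒∣m+n ℕD.∣-refl) (λ 3∣3+n → ℕD.∣m+n∣m⇒∣n 3∣3+n ℕD.∣-refl)

2-periodic⇒⇔∤2 : ∀ {Q : ℕ → Set} → ¬ Q 0 → Q 1 → (∀ n → Q (2 ℕ.+ n) ⇔ Q n) →
                 ∀ n → Q n ⇔ (¬ 2 ℕD.∣ n)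
2-periodic⇒⇔∤2 ¬Q₀ Q₁ period zero = mk⇔ (⊥-elim ∘ ¬Q₀) (λ 2∤0 → ⊥-elim (2∤0 (2 ℕD.∣0)))
2-periodic⇒⇔∤2 ¬Q₀ Q₁ period 1 = mk⇔ (λ _ → from-no (2 ℕD.∣? 1)) (λ _ → Q₁)
2-periodic⇒⇔∤2 ¬Q₀ Q₁ period (suc (suc n)) =
  ⇔.trans (period n) (⇔.trans (2-periodic⇒⇔∤2 ¬Q₀ Q₁ period n) (¬-cong-⇔ 2∣n⇔2∣2+n))
  where
  2∣n⇔2∣2+n : 2 ℕD.∣ n ⇔ 2 ℕD.∣ 2 ℕ.+ n
  2∣n⇔2∣2+n = mk⇔ (ℕD.∣m∣n⇒∣m+n ℕD.∣-refl) (λ 2∣2+n → ℕD.∣m+n∣m⇒∣n 2∣2+n ℕD.∣-refl)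

module _ {r : ℤ} {Z : ℕ → ℤ} (rec : Recurrent r Z) {m : ℤ} where

  ∣Z+1⇔∤3 : Z 0 ≡ + 2 → Z 1 ≡ r → m ∣ r + + 1 → ¬ m ∣ + 3 →
            ∀ n → m ∣ Z n + + 1 ⇔ (¬ 3 ℕD.∣ n)
  ∣Z+1⇔∤3 Z₀≡2 Z₁≡r m∣r+1 m∤3 = 3-periodic⇒⇔∤3 ¬Q₀ Q₁ Q₂ period
    where
    ¬Q₀ : ¬ m ∣ Z 0 + + 1
    ¬Q₀ rewrite Z₀≡2 = m∤3
    Q₁ : m ∣ Z 1 + + 1
    Q₁ rewrite Z₁≡r = m∣r+1
    factor : ∀ r → r * r - + 2 + + 1 ≡ (r - + 1) * (r + + 1)
    factor = solve-∀
    Q₂ : m ∣ Z 2 + + 1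
    Q₂ rewrite recurrence rec 0 | Z₀≡2 | Z₁≡r = ∣-trans m∣r+1 (divides (r - + 1) (factor r))
    shift : ∀ a b → a - b ≡ (a + + 1) - (b + + 1)
    shift = solve-∀
    period : ∀ n → m ∣ Z (3 ℕ.+ n) + + 1 ⇔ m ∣ Z n + + 1
    period n = ∣m-n⇒∣m⇔∣n
      (∣-trans m∣r+1 (subst (r + + 1 ∣_) (shift (Z (3 ℕ.+ n)) (Z n)) (r+1∣X₃₊ₙ-Xₙ rec n)))

  ∤Z⇔∤3 : m ∣ r + + 1 → m ∣ Z 0 → ¬ m ∣ Z 1 → ∀ n → (¬ m ∣ Z n) ⇔ (¬ 3 ℕD.∣ n)
  ∤Z⇔∤3 m∣r+1 m∣Z₀ m∤Z₁ = 3-periodic⇒⇔∤3 (λ m∤Z₀ → m∤Z₀ m∣Z₀) m∤Z₁ m∤Z₂ period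
    where
    Z₁≡ : (r + + 1) * Z 1 - (Z 2 + Z 0) ≡ Z 1
    Z₁≡ = trans (cong (λ z → (r + + 1) * Z 1 - (z + Z 0)) (recurrence rec 0)) (cancel r (Z 1) (Z 0))
      where
      cancel : ∀ r a b → (r + + 1) * a - ((r * a - b) + b) ≡ a
      cancel = solve-∀
    m∤Z₂ : ¬ m ∣ Z 2
    m∤Z₂ m∣Z₂ =
      m∤Z₁ (subst (m ∣_) Z₁≡ (∣m∣n⇒∣m-n (∣m⇒∣m*n (Z 1) m∣r+1) (∣m∣n⇒∣m+n m∣Z₂ m∣Z₀)))
    period : ∀ n → (¬ m ∣ Z (3 ℕ.+ n)) ⇔ (¬ m ∣ Z n)
    period n = ¬-cong-⇔ (∣m-n⇒∣m⇔∣n (∣-trans m∣r+1 (r+1∣X₃₊ₙ-Xₙ rec n)))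

  ∤Z⇔∤2 : m ∣ r → m ∣ Z 0 → ¬ m ∣ Z 1 → ∀ n → (¬ m ∣ Z n) ⇔ (¬ 2 ℕD.∣ n)
  ∤Z⇔∤2 m∣r m∣Z₀ m∤Z₁ = 2-periodic⇒⇔∤2 (λ m∤Z₀ → m∤Z₀ m∣Z₀) m∤Z₁ period
    where
    period : ∀ n → (¬ m ∣ Z (2 ℕ.+ n)) ⇔ (¬ m ∣ Z n)
    period n = ¬-cong-⇔ (∣m+n⇒∣m⇔∣n (∣-trans m∣r (r∣X₂₊ₙ+Xₙ rec n)))

parity : ∀ x → + 2 ∣ x ⊎ + 2 ∣ x + + 1
parity x with x ℤDivMod.% + 2 | ℤDivMod.n%d<d x (+ 2) | ℤDivMod.a≡a%n+[a/n]*n x (+ 2)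
... | zero | _ | x≡ = inj₁ (divides (x ℤDivMod./ + 2) (trans x≡ (ℤP.+-identityˡ _)))
... | suc zero | _ | x≡ =
  inj₂ (divides (x ℤDivMod./ + 2 + + 1) (trans (cong (_+ + 1) x≡) (regroup (x ℤDivMod./ + 2))))
  where
  regroup : ∀ q → (+ 1 + q * + 2) + + 1 ≡ (q + + 1) * + 2
  regroup = solve-∀
... | suc (suc _) | s≤s (s≤s ()) | _

2∣x⇒2∤x+1 : ∀ {x} → + 2 ∣ x → ¬ + 2 ∣ x + + 1
2∣x⇒2∤x+1 2∣x 2∣x+1 = from-no (+ 2 ∣? + 1) (∣m+n∣m⇒∣n 2∣x+1 2∣x)

2∤x⇒2∣x+1 : ∀ {x} → ¬ + 2 ∣ x → + 2 ∣ x + + 1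
2∤x⇒2∣x+1 {x} 2∤x with parity x
... | inj₁ 2∣x   = ⊥-elim (2∤x 2∣x)
... | inj₂ 2∣x+1 = 2∣x+1

2∤x+1⇒2∣x : ∀ {x} → ¬ + 2 ∣ x + + 1 → + 2 ∣ x
2∤x+1⇒2∣x {x} 2∤x+1 with parity x
... | inj₁ 2∣x   = 2∣x
... | inj₂ 2∣x+1 = ⊥-elim (2∤x+1 2∣x+1)

even-square : ∀ x → + 2 ∣ x → + 4 ∣ x * x - + 4
even-square x (divides q x≡) = divides (q * q - + 1) (begin
  x * x - + 4                   ≡⟨ cong (λ y → y * y - + 4) x≡ ⟩
  (q * + 2) * (q * + 2) - + 4   ≡⟨ factor q ⟩
  (q * q - + 1) * + 4           ∎)
  where
  open ≡-Reasoning
  factor : ∀ q → (q * + 2) * (q * + 2) - + 4 ≡ (q * q - + 1) * + 4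
  factor = solve-∀

odd-square : ∀ x → + 2 ∣ x + + 1 → + 4 ∣ x * x - + 1
odd-square x (divides q x+1≡) = divides (q * (q - + 1)) (begin
  x * x - + 1                           ≡⟨ difference x ⟩
  (x + + 1) * ((x + + 1) - + 2)         ≡⟨ cong (λ y → y * (y - + 2)) x+1≡ ⟩
  (q * + 2) * ((q * + 2) - + 2)         ≡⟨ factor q ⟩
  q * (q - + 1) * + 4                   ∎)
  where
  open ≡-Reasoning
  difference : ∀ x → x * x - + 1 ≡ (x + + 1) * ((x + + 1) - + 2)
  difference = solve-∀
  factor : ∀ q → (q * + 2) * ((q * + 2) - + 2) ≡ q * (q - + 1) * + 4
  factor = solve-∀

4∣x²-4-1⇔2∣x+1 : ∀ x → + 4 ∣ x * x - + 4 - + 1 ⇔ + 2 ∣ x + + 1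
4∣x²-4-1⇔2∣x+1 x = mk⇔ to from
  where
  swap : x * x - + 1 - + 4 ≡ x * x - + 4 - + 1
  swap = commute (x * x)
    where
    commute : ∀ a → a - + 1 - + 4 ≡ a - + 4 - + 1
    commute = solve-∀
  from : + 2 ∣ x + + 1 → + 4 ∣ x * x - + 4 - + 1
  from 2∣x+1 = subst (+ 4 ∣_) swap (∣m∣n⇒∣m-n (odd-square x 2∣x+1) ∣-refl)
  to : + 4 ∣ x * x - + 4 - + 1 → + 2 ∣ x + + 1
  to 4∣x²-5 with parity x
  ... | inj₂ 2∣x+1 = 2∣x+1
  ... | inj₁ 2∣x   = ⊥-elim (from-no (+ 4 ∣? - + 1) (∣m+n∣m⇒∣n 4∣x²-5 (even-square x 2∣x)))

module Pell {x y D : ℤ} (pell : x * x - D * (y * y) ≡ + 4) where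

  private
    x²≡Dy²+4 : x * x ≡ D * (y * y) + + 4
    x²≡Dy²+4 = trans (expand (x * x) (D * (y * y))) (cong (λ c → D * (y * y) + c) pell)
      where
      expand : ∀ a b → a ≡ b + (a - b)
      expand = solve-∀

  even-x⇒4∣D : + 2 ∣ x → ¬ + 2 ∣ y → + 4 ∣ D
  even-x⇒4∣D 2∣x 2∤y = subst (+ 4 ∣_) D≡
    (∣m∣n⇒∣m-n (even-square x 2∣x) (∣n⇒∣m*n D (odd-square y (2∤x⇒2∣x+1 2∤y))))
    where
    identity : ∀ D w → D * w + + 4 - + 4 - D * (w - + 1) ≡ D
    identity = solve-∀
    D≡ : x * x - + 4 - D * (y * y - + 1) ≡ D
    D≡ rewrite x²≡Dy²+4 = identity D (y * y)

  odd-x⇒odd-y : + 2 ∣ x + + 1 → ¬ + 2 ∣ y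
  odd-x⇒odd-y 2∣x+1 2∣y = from-no (+ 2 ∣? + 3) (subst (+ 2 ∣_) 3≡
    (∣m∣n⇒∣m-n (∣-trans (divides (+ 2) refl) (odd-square x 2∣x+1)) (∣n⇒∣m*n D (∣n⇒∣m*n y 2∣y))))
    where
    identity : ∀ D w → D * w + + 4 - + 1 - D * w ≡ + 3
    identity = solve-∀
    3≡ : x * x - + 1 - D * (y * y) ≡ + 3
    3≡ rewrite x²≡Dy²+4 = identity D (y * y)

  odd-x⇒4∣D-1 : + 2 ∣ x + + 1 → + 4 ∣ D - + 1
  odd-x⇒4∣D-1 2∣x+1 = subst (+ 4 ∣_) D-1≡
    (∣m∣n⇒∣m-n (∣m∣n⇒∣m-n (odd-square x 2∣x+1) ∣-refl)
               (∣n⇒∣m*n D (odd-square y (2∤x⇒2∣x+1 (odd-x⇒odd-y 2∣x+1)))))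
    where
    identity : ∀ D w → D * w + + 4 - + 1 - + 4 - D * (w - + 1) ≡ D - + 1
    identity = solve-∀
    D-1≡ : x * x - + 1 - + 4 - D * (y * y - + 1) ≡ D - + 1
    D-1≡ rewrite x²≡Dy²+4 = identity D (y * y)

V-norm : ∀ {D t u} → t ℕ.* t ≡ D ℕ.* (u ℕ.* u) ℕ.+ 4 →
         ∀ k → V t k * V t k - + D * (Y t u k * Y t u k) ≡ + 4
V-norm {D} {t} {u} pell k = proj₁ (invariant k)
  where
  open ≡-Reasoning
  -- N k = 4 alone does not propagate through the recurrence; together with
  -- M k, the norm form polarised at (ε^k, ε^(k+1)), it does.
  N M : ℕ → ℤ
  N k = V t k * V t k - + D * (Y t u k * Y t u k)
  M k = V t k * V t (suc k) - + D * (Y t u k * Y t u (suc k))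
  M-step : ∀ T D v₀ v₁ y₀ y₁ →
    v₁ * (T * v₁ - v₀) - D * (y₁ * (T * y₁ - y₀)) ≡
    T * (v₁ * v₁ - D * (y₁ * y₁)) - (v₀ * v₁ - D * (y₀ * y₁))
  M-step = solve-∀
  N-step : ∀ T D v₀ v₁ y₀ y₁ →
    (T * v₁ - v₀) * (T * v₁ - v₀) - D * ((T * y₁ - y₀) * (T * y₁ - y₀)) ≡
    T * T * (v₁ * v₁ - D * (y₁ * y₁)) - + 2 * T * (v₀ * v₁ - D * (y₀ * y₁))
      + (v₀ * v₀ - D * (y₀ * y₀))
  N-step = solve-∀
  N₀ : ∀ D → + 2 * + 2 - D * (+ 0 * + 0) ≡ + 4
  N₀ = solve-∀
  M₀ : ∀ D T U → + 2 * T - D * (+ 0 * U) ≡ + 2 * T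
  M₀ = solve-∀
  N₁ : N 1 ≡ + 4
  N₁ = begin
    + t * + t - + D * (+ u * + u)
      ≡⟨ cong₂ (λ a b → a - + D * b) (sym (ℤP.pos-* t t)) (sym (ℤP.pos-* u u)) ⟩
    + (t ℕ.* t) - + D * + (u ℕ.* u)
      ≡⟨ cong₂ (λ a b → + a - b) pell (sym (ℤP.pos-* D (u ℕ.* u))) ⟩
    + (w ℕ.+ 4) - + w
      ≡⟨ cong (_- + w) (ℤP.pos-+ w 4) ⟩
    + w + + 4 - + w
      ≡⟨ cancel (+ w) ⟩
    + 4 ∎
    where
    w = D ℕ.* (u ℕ.* u)
    cancel : ∀ a → a + + 4 - a ≡ + 4
    cancel = solve-∀
  M-value : ∀ T → T * + 4 - + 2 * T ≡ + 2 * T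
  M-value = solve-∀
  N-value : ∀ T → T * T * + 4 - + 2 * T * (+ 2 * T) + + 4 ≡ + 4
  N-value = solve-∀
  invariant : ∀ k → N k ≡ + 4 × M k ≡ + 2 * + t × N (suc k) ≡ + 4
  invariant zero = N₀ (+ D) , M₀ (+ D) (+ t) (+ u) , N₁
  invariant (suc k) with invariant k
  ... | Nₖ , Mₖ , N₁₊ₖ = N₁₊ₖ , M₁₊ₖ , N₂₊ₖ
    where
    v₀ = V t k ; v₁ = V t (suc k) ; y₀ = Y t u k ; y₁ = Y t u (suc k)
    M₁₊ₖ : M (suc k) ≡ + 2 * + t
    M₁₊ₖ = begin
      M (suc k)                     ≡⟨ M-step (+ t) (+ D) v₀ v₁ y₀ y₁ ⟩
      + t * N (suc k) - M k         ≡⟨ cong₂ (λ a b → + t * a - b) N₁₊ₖ Mₖ ⟩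
      + t * + 4 - + 2 * + t         ≡⟨ M-value (+ t) ⟩
      + 2 * + t                     ∎
    N₂₊ₖ : N (2 ℕ.+ k) ≡ + 4
    N₂₊ₖ = begin
      N (2 ℕ.+ k)
        ≡⟨ N-step (+ t) (+ D) v₀ v₁ y₀ y₁ ⟩
      + t * + t * N (suc k) - + 2 * + t * M k + N k
        ≡⟨ cong₂ (λ a b → + t * + t * a - + 2 * + t * b + N k) N₁₊ₖ Mₖ ⟩
      + t * + t * + 4 - + 2 * + t * (+ 2 * + t) + N k
        ≡⟨ cong (λ c → + t * + t * + 4 - + 2 * + t * (+ 2 * + t) + c) Nₖ ⟩
      + t * + t * + 4 - + 2 * + t * (+ 2 * + t) + + 4
        ≡⟨ N-value (+ t) ⟩
      + 4 ∎

3≤t : ∀ {D t u} → 1 < D → 0 < u → t ℕ.* t ≡ D ℕ.* (u ℕ.* u) ℕ.+ 4 → 3 ℕ.≤ t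
3≤t {suc (suc D)} {t} {suc u} (s≤s (s≤s _)) _ pell = bound t (trans pell (ℕP.+-comm _ 4))
  where
  bound : ∀ t → t ℕ.* t ≡ 4 ℕ.+ suc (suc D) ℕ.* (suc u ℕ.* suc u) → 3 ℕ.≤ t
  bound zero ()
  bound (suc zero) ()
  bound (suc (suc zero)) ()
  bound (suc (suc (suc t))) _ = s≤s (s≤s (s≤s ℕ.z≤n))

V-growth : ∀ s k → ∃₂ λ a b → V (3 ℕ.+ s) k ≡ + (2 ℕ.+ a) × V (3 ℕ.+ s) (suc k) ≡ + (3 ℕ.+ a ℕ.+ b)
V-growth s zero = 0 , s , refl , refl
V-growth s (suc k) with V-growth s k
... | a , b , Vₖ , V₁₊ₖ = a₁ , b₁ , V₁₊ₖ , V₂₊ₖ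
  where
  open ≡-Reasoning
  a₁ = 1 ℕ.+ a ℕ.+ b
  b₁ = 3 ℕ.+ a ℕ.+ 2 ℕ.* b ℕ.+ s ℕ.* (3 ℕ.+ a ℕ.+ b)
  expand : ∀ s a b → (3 ℕ.+ s) ℕ.* (3 ℕ.+ a ℕ.+ b) ≡
    2 ℕ.+ a ℕ.+ (3 ℕ.+ (1 ℕ.+ a ℕ.+ b) ℕ.+ (3 ℕ.+ a ℕ.+ 2 ℕ.* b ℕ.+ s ℕ.* (3 ℕ.+ a ℕ.+ b)))
  expand = ℕSolver.solve-∀
  cancel : ∀ a c → a + c - a ≡ c
  cancel = solve-∀
  V₂₊ₖ : V (3 ℕ.+ s) (2 ℕ.+ k) ≡ + (3 ℕ.+ a₁ ℕ.+ b₁)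
  V₂₊ₖ = begin
    + (3 ℕ.+ s) * V (3 ℕ.+ s) (suc k) - V (3 ℕ.+ s) k
      ≡⟨ cong₂ (λ v w → + (3 ℕ.+ s) * v - w) V₁₊ₖ Vₖ ⟩
    + (3 ℕ.+ s) * + (3 ℕ.+ a ℕ.+ b) - + (2 ℕ.+ a)
      ≡⟨ cong (_- + (2 ℕ.+ a)) (sym (ℤP.pos-* (3 ℕ.+ s) (3 ℕ.+ a ℕ.+ b))) ⟩
    + ((3 ℕ.+ s) ℕ.* (3 ℕ.+ a ℕ.+ b)) - + (2 ℕ.+ a)
      ≡⟨ cong (λ m → + m - + (2 ℕ.+ a)) (expand s a b) ⟩
    + (2 ℕ.+ a ℕ.+ (3 ℕ.+ a₁ ℕ.+ b₁)) - + (2 ℕ.+ a)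
      ≡⟨ cong (_- + (2 ℕ.+ a)) (ℤP.pos-+ (2 ℕ.+ a) (3 ℕ.+ a₁ ℕ.+ b₁)) ⟩
    + (2 ℕ.+ a) + + (3 ℕ.+ a₁ ℕ.+ b₁) - + (2 ℕ.+ a)
      ≡⟨ cancel (+ (2 ℕ.+ a)) (+ (3 ℕ.+ a₁ ℕ.+ b₁)) ⟩
    + (3 ℕ.+ a₁ ℕ.+ b₁) ∎

d∤3 : ∀ {t j} → 3 ℕ.≤ t → 0 < j → ¬ d t j ∣ + 3
d∤3 {suc (suc (suc s))} {suc k} (s≤s (s≤s (s≤s _))) _ d∣3 with V-growth s k
... | a , b , _ , V₁₊ₖ = ℕD.>⇒∤ 3<d (∣⇒∣ᵤ (subst (λ v → v + + 1 ∣ + 3) V₁₊ₖ d∣3))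
  where
  3<d : 3 < 3 ℕ.+ a ℕ.+ b ℕ.+ 1
  3<d = s≤s (s≤s (s≤s (ℕP.m≤n+m 1 (a ℕ.+ b))))

Δ≡V²-4 : ∀ t k → Δ t k ≡ V t k * V t k - + 4
Δ≡V²-4 t k = expand (V t k)
  where
  expand : ∀ x → (x + + 1 - + 3) * (x + + 1 + + 1) ≡ x * x - + 4
  expand = solve-∀

4∣Δ-1⇔2∣d : ∀ t k → + 4 ∣ Δ t k - + 1 ⇔ + 2 ∣ d t k
4∣Δ-1⇔2∣d t k rewrite Δ≡V²-4 t k = 4∣x²-4-1⇔2∣x+1 (V t k)

d∣d⇔∤3 : ∀ {t j} → 3 ℕ.≤ t → 0 < j → ∀ n → (d t j ℤD.∣ d t (n ℕ.* j)) ⇔ (¬ 3 ℕD.∣ n)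
d∣d⇔∤3 {t} {j} 3≤t 0<j n = ⇔.trans ∣ᵤ⇔∣
  (∣Z+1⇔∤3 (recurrent-∘* (V-recurrent t) j) refl (X[1*j]≡X[j] (V t) j) ∣-refl (d∤3 3≤t 0<j) n)

module _ {D t u j : ℕ} (norm : V t j * V t j - + D * (f t u j * f t u j) ≡ + 4) (n : ℕ) where

  private
    Vⱼ-rec : Recurrent (V t j) (λ n → V t (n ℕ.* j))
    Vⱼ-rec = recurrent-∘* (V-recurrent t) j
    Yⱼ-rec : Recurrent (V t j) (λ n → Y t u (n ℕ.* j))
    Yⱼ-rec = recurrent-∘* (Y-recurrent t u) j
    2∣0 : + 2 ∣ + 0
    2∣0 = divides (+ 0) refl
    V₁ : V t (1 ℕ.* j) ≡ V t j
    V₁ = X[1*j]≡X[j] (V t) j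
    Y₁ : Y t u (1 ℕ.* j) ≡ Y t u j
    Y₁ = X[1*j]≡X[j] (Y t u) j
    open Pell {V t j} {f t u j} {+ D} norm

  odd-d-properties : ¬ (+ 2 ℤD.∣ d t j) →
    ((¬ (+ 2 ℤD.∣ f t u j)) → 4 ℕD.∣ D)
    × (+ 4 ℤD.∣ Δ t (n ℕ.* j))
    × (¬ (+ 2 ℤD.∣ d t (n ℕ.* j)))
    × ((+ 2 ℤD.∣ f t u j) → + 2 ℤD.∣ f t u (n ℕ.* j))
    × ((¬ (+ 2 ℤD.∣ f t u j)) → ((¬ (+ 2 ℤD.∣ f t u (n ℕ.* j))) ⇔ (¬ (2 ℕD.∣ n))))
  odd-d-properties d-odd =
      (λ f-odd → ∣⇒∣ᵤ (even-x⇒4∣D r-even (f-odd ∘ ∣⇒∣ᵤ)))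
    , ∣⇒∣ᵤ (subst (+ 4 ∣_) (sym (Δ≡V²-4 t (n ℕ.* j))) (even-square _ Vₙⱼ-even))
    , 2∣x⇒2∤x+1 Vₙⱼ-even ∘ ∣ᵤ⇒∣
    , (λ f-even → ∣⇒∣ᵤ (recurrent-∣ Yⱼ-rec 2∣0 (subst (+ 2 ∣_) (sym Y₁) (∣ᵤ⇒∣ f-even)) n))
    , (λ f-odd → ⇔.trans (¬-cong-⇔ ∣ᵤ⇔∣)
        (∤Z⇔∤2 Yⱼ-rec r-even 2∣0 (subst (λ y → ¬ + 2 ∣ y) (sym Y₁) (f-odd ∘ ∣⇒∣ᵤ)) n))
    where
    r-even : + 2 ∣ V t j
    r-even = 2∤x+1⇒2∣x (d-odd ∘ ∣⇒∣ᵤ)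
    Vₙⱼ-even : + 2 ∣ V t (n ℕ.* j)
    Vₙⱼ-even = recurrent-∣ Vⱼ-rec (divides (+ 1) refl) (subst (+ 2 ∣_) (sym V₁) r-even) n

  even-d-properties : (+ 2 ℤD.∣ d t j) →
    (4 ℕD.∣ (D ℕ.∸ 1))
    × ((+ 4 ℤD.∣ (Δ t (n ℕ.* j) ℤ.- + 1)) ⇔ (¬ (3 ℕD.∣ n)))
    × ((+ 2 ℤD.∣ d t (n ℕ.* j)) ⇔ (¬ (3 ℕD.∣ n)))
    × ((¬ (+ 2 ℤD.∣ f t u (n ℕ.* j))) ⇔ (¬ (3 ℕD.∣ n)))
  even-d-properties d-even =
      ∣m-1⇒∣m∸1 {m = D} (odd-x⇒4∣D-1 r-odd)
    , ⇔.trans ∣ᵤ⇔∣ (⇔.trans (4∣Δ-1⇔2∣d t (n ℕ.* j)) 2∣dₙⱼ⇔∤3)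
    , ⇔.trans ∣ᵤ⇔∣ 2∣dₙⱼ⇔∤3
    , ⇔.trans (¬-cong-⇔ ∣ᵤ⇔∣) (∤Z⇔∤3 Yⱼ-rec r-odd 2∣0 f-odd n)
    where
    r-odd : + 2 ∣ V t j + + 1
    r-odd = ∣ᵤ⇒∣ d-even
    f-odd : ¬ + 2 ∣ Y t u (1 ℕ.* j)
    f-odd = subst (λ y → ¬ + 2 ∣ y) (sym Y₁) (odd-x⇒odd-y r-odd)
    2∣dₙⱼ⇔∤3 : + 2 ∣ d t (n ℕ.* j) ⇔ (¬ 3 ℕD.∣ n)
    2∣dₙⱼ⇔∤3 = ∣Z+1⇔∤3 Vⱼ-rec refl V₁ r-odd (from-no (+ 2 ∣? + 3)) n

lemma4p10 : (Δ₀ t u : ℕ) → IsRealQuadDisc Δ₀ → IsSmallestNormOneUnit Δ₀ t u →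
    (j n : ℕ) → 0 < j → 0 < n →
    ((d t j ℤD.∣ d t (n ℕ.* j)) ⇔ (¬ (3 ℕD.∣ n)))
    × ((¬ (+ 2 ℤD.∣ d t j)) →
        ((¬ (+ 2 ℤD.∣ f t u j)) → 4 ℕD.∣ Δ₀)
        × (+ 4 ℤD.∣ Δ t (n ℕ.* j))
        × (¬ (+ 2 ℤD.∣ d t (n ℕ.* j)))
        × ((+ 2 ℤD.∣ f t u j) → + 2 ℤD.∣ f t u (n ℕ.* j))
        × ((¬ (+ 2 ℤD.∣ f t u j)) → ((¬ (+ 2 ℤD.∣ f t u (n ℕ.* j))) ⇔ (¬ (2 ℕD.∣ n)))))
    × ((+ 2 ℤD.∣ d t j) →
        (4 ℕD.∣ (Δ₀ ℕ.∸ 1))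
        × ((+ 4 ℤD.∣ (Δ t (n ℕ.* j) ℤ.- + 1)) ⇔ (¬ (3 ℕD.∣ n)))
        × ((+ 2 ℤD.∣ d t (n ℕ.* j)) ⇔ (¬ (3 ℕD.∣ n)))
        × ((¬ (+ 2 ℤD.∣ f t u (n ℕ.* j))) ⇔ (¬ (3 ℕD.∣ n))))
lemma4p10 Δ₀ t u (1<Δ₀ , _) ((_ , 0<u , pell) , _) j n 0<j _ =
    d∣d⇔∤3 (3≤t 1<Δ₀ 0<u pell) 0<j n
  , odd-d-properties {Δ₀} norm n
  , even-d-properties {Δ₀} norm n
  where
  norm : V t j * V t j - + Δ₀ * (f t u j * f t u j) ≡ + 4
  norm = V-norm {Δ₀} {t} {u} pell j
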